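{- Let $T$ be a finite tree, let $r$ be any vertex of $T$, and let $\mathcal{P}$ be the partition produced by outward-contraction with root $r$. Let $\overline{T}=T(\mathcal{P})$ be the resulting partition-tree and $\varphi:V(T)\to V(\overline{T})$ the natural mapping. Then the center-shift of $\varphi$ is zero, i.e. $\varphi^{ -1}(C_{\overline{T}})\cap C_T\neq\emptyset$, where $C_T$ and $C_{\overline{T}}$ are the centers of $T$ and $\overline{T}$.
   Context: Distances are shortest-path distances; the eccentricity of $v$ is $\max_x d(v,x)$ and the center is the set of vertices of minimum eccentricity. Outward-contraction: with root $r$, let $\mathrm{lev}(v)=d(v,r)$; for every vertex $v$ with $\mathrm{lev}(v)$ even, let $N_\downarrow(v)$ be the set of neighbours $u$ of $v$ with $\mathrm{lev}(u)>\mathrm{lev}(v)$, and form the super-vertex $\{v\}\cup N_\downarrow(v)$; these super-vertices form a partition $\mathcal{P}$ of $V(T)$. The partition-graph $T(\mathcal{P})$ has the super-vertices as vertices, two distinct super-vertices being adjacent iff some vertex of one is adjacent in $T$ to some vertex of the other; the natural mapping sends each vertex to the super-vertex containing it. The center-shift of a surjective map $\varphi:G\to H$ is $d_G(C_G,\varphi^{ -1}(C_H))$, where $d_G(S_1,S_2)=\min\{d_G(a,b):a\in S_1,b\in S_2\}$. -}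

module Defs where

open import Data.Nat using (ℕ; zero; suc; _≤_; _<_)
open import Data.Nat.Divisibility using (_∣_)
open import Data.Fin using (Fin)
open import Data.List using (List; []; _∷_; _++_; [_]; length)
open import Data.List.Relation.Unary.Linked using (Linked)
open import Data.List.Relation.Unary.Unique.Propositional using (Unique)
open import Data.Product using (Σ; _×_; proj₁; ∃; ∃-syntax)
open import Data.Sum using (_⊎_)
open import Data.Empty using (⊥)
open import Data.Irrelevant using (Irrelevant)
open import Relation.Binary.PropositionalEquality using (_≡_; _≢_)

record Graph : Set₁ where
  field
    V   : Set
    Adj : V → V → Set

module _ (G : Graph) where
  open Graph G

  data Walk : V → V → ℕ → Set where
    nil  : ∀ {u} → Walk u u 0
    cons : ∀ {u w v k} → Adj u w → Walk w v k → Walk u v (suc k)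

  Dist : V → V → ℕ → Set
  Dist u v k = Walk u v k × (∀ m → Walk u v m → k ≤ m)

  Ecc : V → ℕ → Set
  Ecc v e = (∀ x k → Dist v x k → k ≤ e) × (Σ V λ x → Dist v x e)

  InCenter : V → Set
  InCenter v = Σ ℕ λ e → Ecc v e × (∀ w e′ → Ecc w e′ → e ≤ e′)

record IsTree (n : ℕ) (Adj : Fin n → Fin n → Set) : Set where
  field
    sym       : ∀ {u v} → Adj u v → Adj v u
    irrefl    : ∀ {u} → Adj u u → ⊥
    connected : ∀ u v → ∃[ k ] Walk (record { V = Fin n ; Adj = Adj }) u v k
    -- no cycle x, y₁, …, y_k, x with k ≥ 2 and x, y₁, …, y_k distinct
    acyclic   : ∀ x ys → 2 ≤ length ys → Unique (x ∷ ys) →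
                Linked Adj (x ∷ ys ++ [ x ]) → ⊥

treeGraph : (n : ℕ) → (Fin n → Fin n → Set) → Graph
treeGraph n Adj = record { V = Fin n ; Adj = Adj }

module OutwardContraction (n : ℕ) (Adj : Fin n → Fin n → Set) (r : Fin n) where

  T : Graph
  T = treeGraph n Adj

  Lev : Fin n → ℕ → Set
  Lev v k = Dist T v r k

  EvenLev : Fin n → Set
  EvenLev v = ∃[ k ] (Lev v k × 2 ∣ k)

  Down : Fin n → Fin n → Set
  Down v u = Adj v u × ∃[ kv ] ∃[ ku ] (Lev v kv × Lev u ku × kv < ku)

  InSuper : Fin n → Fin n → Set
  InSuper v u = u ≡ v ⊎ Down v u

  -- super-vertices, represented by their (even-level) generating vertex;
  -- the evenness proof is irrelevant so each super-vertex occurs once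
  SuperVertex : Set
  SuperVertex = Σ (Fin n) λ v → Irrelevant (EvenLev v)

  PAdj : SuperVertex → SuperVertex → Set
  PAdj S S′ = proj₁ S ≢ proj₁ S′ ×
              ∃[ a ] ∃[ b ] (InSuper (proj₁ S) a × InSuper (proj₁ S′) b × Adj a b)

  PartitionGraph : Graph
  PartitionGraph = record { V = SuperVertex ; Adj = PAdj }

  φ-maps : Fin n → SuperVertex → Set
  φ-maps u S = InSuper (proj₁ S) u

-- Root T at r, write lev for the level of a vertex and meet x y for the level
-- of the lowest common ancestor of x and y.  The tree distance is
-- d x y = (lev x ∸ meet x y) + (lev y ∸ meet x y).  A super-vertex is an even
-- vertex together with its children, and the distance in the partition graph
-- between the super-vertices of x and y is w x y, the same expression with every
-- level replaced by its half ⌊_/2⌋; w is constant on super-vertices.  Both d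
-- and w are additive along geodesics of T, and as 2 w and d agree up to parity
-- bits, d c y ≤ d c z implies w c y ≤ 1 + w c z.
--
-- Take a diametral path of T.  If its length 2R is even, its midpoint c is the
-- centre of T and every vertex v meets c on its geodesic to an end z of the
-- path; then w v z = w v c + w c z, which is at least 1 + w c z ≥ w c y for all
-- y unless w v c = 0, so φ(c) also has minimal eccentricity in the partition
-- graph.  If the length is 2R + 1, T has two adjacent centres c₁ and c₂, every
-- vertex lies on the side of one of them, and the same argument applies to
-- the centre whose own side contains the vertex that is w-farthest from it.

module Submission where

open import Defs
open import Data.Nat using (ℕ; zero; suc; pred; _≤_; _<_; s≤s; z≤n; _+_; _*_; _∸_; ⌊_/2⌋)
open import Data.Nat.Properties
open import Data.Nat.Divisibility using (_∣_; divides)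
open import Data.Nat.Solver using (module +-*-Solver)
open import Data.Fin using (Fin)
import Data.Fin.Properties as Fin
open import Data.Irrelevant using ([_])
open import Data.List using (List; []; _∷_; _++_; length; allFin; filter)
open import Data.List.Properties using (length-++; ∷-injective; ∷-injectiveˡ; ∷-injectiveʳ)
open import Data.List.Extrema.Nat using (argmax; f[xs]≤f[argmax]; argmax-all)
open import Data.List.Membership.Propositional using (_∈_; _∉_)
open import Data.List.Membership.Propositional.Properties using (∈-++⁺ʳ; ∈-++⁻; ∈-∃++; ∈-allFin; ∈-filter⁺)
import Data.List.Membership.DecPropositional as DecMembership
open import Data.List.Relation.Binary.Subset.Propositional using (_⊆_)
open import Data.List.Relation.Unary.All as All using (All; []; _∷_)
open import Data.List.Relation.Unary.All.Properties using (All¬⇒¬Any; ¬Any⇒All¬; anti-mono; all-filter)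
open import Data.List.Relation.Unary.AllPairs using ([]; _∷_)
open import Data.List.Relation.Unary.Any using (here; there)
open import Data.List.Relation.Unary.Linked using (Linked; [-]; _∷_)
open import Data.List.Relation.Unary.Unique.Propositional using (Unique)
open import Data.Product using (Σ; _×_; _,_; proj₁; proj₂; ∃; ∃-syntax; ∃₂)
open import Data.Sum using (_⊎_; inj₁; inj₂; swap; map₂)
open import Data.Empty using (⊥; ⊥-elim; ⊥-elim-irr)
open import Function using (id; _∘_)
open import Level using (0ℓ)
open import Relation.Nullary using (Dec; yes; no; contradiction)
open import Relation.Unary using (Pred; Decidable)
open import Relation.Binary using (tri<; tri≈; tri>)
open import Relation.Binary.PropositionalEquality

open +-*-Solver using (solve; _:+_; _:=_; con)

private variable
  k m n : ℕ

data Even : ℕ → Set where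
  even-zero : Even 0
  even-ss   : Even n → Even (suc (suc n))

Even-ss⁻¹ : Even (suc (suc n)) → Even n
Even-ss⁻¹ (even-ss e) = e

even-or-odd : ∀ n → Even n ⊎ Even (suc n)
even-or-odd zero = inj₁ even-zero
even-or-odd (suc n) with even-or-odd n
... | inj₁ e = inj₂ (even-ss e)
... | inj₂ o = inj₁ o

odd⇒≡suc : Even (suc n) → ∃[ k ] n ≡ suc k
odd⇒≡suc {suc n} _ = n , refl

even⇒¬odd : Even n → Even (suc n) → ⊥
even⇒¬odd (even-ss e) (even-ss o) = even⇒¬odd e o

Even-+-self : ∀ n → Even (n + n)
Even-+-self zero = even-zero
Even-+-self (suc n) rewrite +-suc n n = even-ss (Even-+-self n)

Even⇒2∣ : Even n → 2 ∣ n
Even⇒2∣ even-zero = divides 0 refl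
Even⇒2∣ (even-ss e) with Even⇒2∣ e
... | divides q eq = divides (suc q) (cong (λ t → suc (suc t)) eq)

2∣⇒Even : 2 ∣ n → Even n
2∣⇒Even (divides q refl) = even-*2 q
  where
  even-*2 : ∀ q → Even (q * 2)
  even-*2 zero = even-zero
  even-*2 (suc q) = even-ss (even-*2 q)

even⇒⌊1+n/2⌋≡⌊n/2⌋ : Even n → ⌊ suc n /2⌋ ≡ ⌊ n /2⌋
even⇒⌊1+n/2⌋≡⌊n/2⌋ even-zero = refl
even⇒⌊1+n/2⌋≡⌊n/2⌋ (even-ss e) = cong suc (even⇒⌊1+n/2⌋≡⌊n/2⌋ e)

even⇒n≡⌊n/2⌋+⌊n/2⌋ : Even n → n ≡ ⌊ n /2⌋ + ⌊ n /2⌋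
even⇒n≡⌊n/2⌋+⌊n/2⌋ even-zero = refl
even⇒n≡⌊n/2⌋+⌊n/2⌋ {suc (suc n)} (even-ss e) =
  cong suc (trans (cong suc (even⇒n≡⌊n/2⌋+⌊n/2⌋ e)) (sym (+-suc ⌊ n /2⌋ ⌊ n /2⌋)))

odd⇒n≡1+⌊n/2⌋+⌊n/2⌋ : Even (suc n) → n ≡ suc (⌊ n /2⌋ + ⌊ n /2⌋)
odd⇒n≡1+⌊n/2⌋+⌊n/2⌋ {suc n} (even-ss e) rewrite even⇒⌊1+n/2⌋≡⌊n/2⌋ e =
  cong suc (even⇒n≡⌊n/2⌋+⌊n/2⌋ e)

⌊1+n/2⌋∸⌊n/2⌋≤1 : ∀ n → ⌊ suc n /2⌋ ∸ ⌊ n /2⌋ ≤ 1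
⌊1+n/2⌋∸⌊n/2⌋≤1 zero = z≤n
⌊1+n/2⌋∸⌊n/2⌋≤1 (suc zero) = s≤s z≤n
⌊1+n/2⌋∸⌊n/2⌋≤1 (suc (suc n)) = ⌊1+n/2⌋∸⌊n/2⌋≤1 n

m∸o≡[m∸n]+[n∸o] : ∀ {m n o} → o ≤ n → n ≤ m → m ∸ o ≡ (m ∸ n) + (n ∸ o)
m∸o≡[m∸n]+[n∸o] {m} {n} {o} o≤n n≤m = begin
  m ∸ o               ≡⟨ cong (_∸ o) (sym (m∸n+n≡m n≤m)) ⟩
  ((m ∸ n) + n) ∸ o   ≡⟨ +-∸-assoc (m ∸ n) o≤n ⟩
  (m ∸ n) + (n ∸ o)   ∎
  where open ≡-Reasoning

≤-tightˡ : ∀ {m n o p} → m ≤ o → n ≤ p → o + p ≤ m + n → m ≡ o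
≤-tightˡ {m} {n} {o} {p} m≤o n≤p o+p≤ = ≤-antisym m≤o (+-cancelʳ-≤ p o m (≤-trans o+p≤ (+-monoʳ-≤ m n≤p)))

≤-tightʳ : ∀ {m n o p} → m ≤ o → n ≤ p → o + p ≤ m + n → n ≡ p
≤-tightʳ {m} {n} {o} {p} m≤o n≤p o+p≤ = ≤-tightˡ n≤p m≤o (subst₂ _≤_ (+-comm o p) (+-comm m n) o+p≤)

+-self-injective : m + m ≡ n + n → m ≡ n
+-self-injective {m} {n} e = trans (n≡⌊n+n/2⌋ m) (trans (cong ⌊_/2⌋ e) (sym (n≡⌊n+n/2⌋ n)))

m+m≢1+n+n : ∀ m n → m + m ≢ suc (n + n)
m+m≢1+n+n m n e = even⇒¬odd (Even-+-self n) (subst Even e (Even-+-self m))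

m+m≤3+n+n⇒m≤1+n : m + m ≤ 3 + (n + n) → m ≤ suc n
m+m≤3+n+n⇒m≤1+n {m} {n} le = begin
  m                          ≡⟨ n≡⌊n+n/2⌋ m ⟩
  ⌊ m + m /2⌋                ≤⟨ ⌊n/2⌋-mono le ⟩
  suc ⌊ suc (n + n) /2⌋      ≡⟨ cong suc (even⇒⌊1+n/2⌋≡⌊n/2⌋ (Even-+-self n)) ⟩
  suc ⌊ n + n /2⌋            ≡⟨ cong suc (sym (n≡⌊n+n/2⌋ n)) ⟩
  suc n                      ∎
  where open ≤-Reasoning

parity : ℕ → ℕ
parity n = n ∸ (⌊ n /2⌋ + ⌊ n /2⌋)

⌊n/2⌋+⌊n/2⌋≤n : ∀ n → ⌊ n /2⌋ + ⌊ n /2⌋ ≤ n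
⌊n/2⌋+⌊n/2⌋≤n zero = z≤n
⌊n/2⌋+⌊n/2⌋≤n (suc zero) = z≤n
⌊n/2⌋+⌊n/2⌋≤n (suc (suc n)) rewrite +-suc ⌊ n /2⌋ ⌊ n /2⌋ = s≤s (s≤s (⌊n/2⌋+⌊n/2⌋≤n n))

⌊n/2⌋+⌊n/2⌋+parity≡n : ∀ n → (⌊ n /2⌋ + ⌊ n /2⌋) + parity n ≡ n
⌊n/2⌋+⌊n/2⌋+parity≡n n = m+[n∸m]≡n (⌊n/2⌋+⌊n/2⌋≤n n)

parity≤1 : ∀ n → parity n ≤ 1
parity≤1 zero = z≤n
parity≤1 (suc zero) = s≤s z≤n
parity≤1 (suc (suc n)) rewrite +-suc ⌊ n /2⌋ ⌊ n /2⌋ = parity≤1 n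

⌊/2⌋-∸ : m ≤ n → (⌊ n /2⌋ ∸ ⌊ m /2⌋) + (⌊ n /2⌋ ∸ ⌊ m /2⌋) + parity n ≡ (n ∸ m) + parity m
⌊/2⌋-∸ {m} {n} m≤n = sym (trans (cong (_+ parity m) n∸m≡) (m∸n+n≡m parity-m≤X))
  where
  hm = ⌊ m /2⌋
  t = ⌊ n /2⌋ ∸ hm
  X = t + t + parity n
  n≡ : n ≡ (hm + hm) + X
  n≡ = begin
    n                                                 ≡⟨ sym (⌊n/2⌋+⌊n/2⌋+parity≡n n) ⟩
    (⌊ n /2⌋ + ⌊ n /2⌋) + parity n                    ≡⟨ cong (λ h → (h + h) + parity n) (sym (m+[n∸m]≡n (⌊n/2⌋-mono m≤n))) ⟩
    ((hm + t) + (hm + t)) + parity n                  ≡⟨ solve 3 (λ a b c → ((a :+ b) :+ (a :+ b)) :+ c := (a :+ a) :+ ((b :+ b) :+ c)) refl hm t (parity n) ⟩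
    (hm + hm) + X                                     ∎
    where open ≡-Reasoning
  m≡ : m ≡ (hm + hm) + parity m
  m≡ = sym (⌊n/2⌋+⌊n/2⌋+parity≡n m)
  n∸m≡ : n ∸ m ≡ X ∸ parity m
  n∸m≡ = trans (cong₂ _∸_ n≡ m≡) ([m+n]∸[m+o]≡n∸o (hm + hm) X (parity m))
  parity-m≤X : parity m ≤ X
  parity-m≤X = +-cancelˡ-≤ (hm + hm) (parity m) X (subst₂ _≤_ m≡ n≡ m≤n)

even⇒parity≡0 : Even n → parity n ≡ 0
even⇒parity≡0 {n} e = trans (cong (_∸ (⌊ n /2⌋ + ⌊ n /2⌋)) (even⇒n≡⌊n/2⌋+⌊n/2⌋ e)) (n∸n≡0 (⌊ n /2⌋ + ⌊ n /2⌋))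

even-halves : Even m → Even n → m ≤ n → n ≡ ((⌊ n /2⌋ ∸ ⌊ m /2⌋) + (⌊ n /2⌋ ∸ ⌊ m /2⌋)) + m
even-halves {m} {n} em en m≤n = begin
  n                          ≡⟨ sym (m∸n+n≡m m≤n) ⟩
  (n ∸ m) + m                ≡⟨ cong (_+ m) (sym (+-identityʳ (n ∸ m))) ⟩
  ((n ∸ m) + 0) + m          ≡⟨ cong (λ p → ((n ∸ m) + p) + m) (sym (even⇒parity≡0 em)) ⟩
  ((n ∸ m) + parity m) + m   ≡⟨ cong (_+ m) (sym (⌊/2⌋-∸ m≤n)) ⟩
  ((h + h) + parity n) + m   ≡⟨ cong (λ p → ((h + h) + p) + m) (even⇒parity≡0 en) ⟩
  ((h + h) + 0) + m          ≡⟨ cong (_+ m) (+-identityʳ (h + h)) ⟩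
  (h + h) + m                ∎
  where
  open ≡-Reasoning
  h = ⌊ n /2⌋ ∸ ⌊ m /2⌋

module _ {G : Graph} where
  open Graph G

  private variable
    t u v w x : V
    i j : ℕ

  _++ʷ_ : Walk G u v i → Walk G v w j → Walk G u w (i + j)
  nil ++ʷ q = q
  cons a p ++ʷ q = cons a (p ++ʷ q)

  _∷ʳʷ_ : Walk G u v i → Adj v w → Walk G u w (suc i)
  nil ∷ʳʷ a = cons a nil
  cons b p ∷ʳʷ a = cons b (p ∷ʳʷ a)

  reverseʷ : (∀ {x y} → Adj x y → Adj y x) → Walk G u v i → Walk G v u i
  reverseʷ Adj-sym nil = nil
  reverseʷ Adj-sym (cons a p) = reverseʷ Adj-sym p ∷ʳʷ Adj-sym a

  splitʷ : ∀ i → Walk G u v (i + j) → ∃[ c ] (Walk G u c i × Walk G c v j)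
  splitʷ zero p = _ , nil , p
  splitʷ (suc i) (cons a p) with splitʷ i p
  ... | c , p₁ , p₂ = c , cons a p₁ , p₂

  Dist-unique : Dist G u v i → Dist G u v j → i ≡ j
  Dist-unique (p , p-min) (q , q-min) = ≤-antisym (p-min _ q) (q-min _ p)

  Dist-triangle : Dist G u v i → Dist G v w j → Dist G u w k → k ≤ i + j
  Dist-triangle (p , _) (q , _) (_ , r-min) = r-min _ (p ++ʷ q)

  Lipschitz : (V → ℕ) → Set
  Lipschitz f = ∀ {x y} → Adj x y → f x ≤ suc (f y)

  Lipschitz⇒≤length : (f : V → ℕ) → f t ≡ 0 → Lipschitz f → Walk G x t k → f x ≤ k
  Lipschitz⇒≤length f ft≡0 lip nil = ≤-reflexive ft≡0
  Lipschitz⇒≤length f ft≡0 lip (cons a p) = ≤-trans (lip a) (s≤s (Lipschitz⇒≤length f ft≡0 lip p))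

  Dist-by-potential : (f : V → ℕ) → f t ≡ 0 → Lipschitz f → Walk G x t (f x) → Dist G x t (f x)
  Dist-by-potential f ft≡0 lip p = p , λ _ → Lipschitz⇒≤length f ft≡0 lip

module _ {A : Set} (dist : A → A → ℕ) where

  MinimalEccentricity : A → Set
  MinimalEccentricity u = ∀ v → ∃[ x ] (∀ y → dist u y ≤ dist v x)

  Farthest : A → A → Set
  Farthest x z = ∀ y → dist x y ≤ dist x z

InCenter-by-MinimalEccentricity : ∀ {G} (dist : Graph.V G → Graph.V G → ℕ) → (∀ x y → Dist G x y (dist x y)) →
                                  ∀ {u z} → Farthest dist u z → MinimalEccentricity dist u → InCenter G u
InCenter-by-MinimalEccentricity dist dist-Dist {u} {z} far min =
  dist u z ,
  ((λ y k d → ≤-trans (≤-reflexive (Dist-unique d (dist-Dist u y))) (far y)) , z , dist-Dist u z) ,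
  λ v e′ (bounded , _) → let (x , u≤v) = min v in ≤-trans (u≤v z) (bounded x _ (dist-Dist v x))

module _ {n : ℕ} where

  argmax-Fin : (f : Fin n → ℕ) → Fin n → ∃[ y ] (∀ z → f z ≤ f y)
  argmax-Fin f x₀ = argmax f x₀ (allFin n) , λ z → All.lookup (f[xs]≤f[argmax] x₀ (allFin n)) (∈-allFin z)

  argmax-Fin-on : (f : Fin n → ℕ) {P : Pred (Fin n) 0ℓ} → Decidable P → ∀ {x₀} → P x₀ →
                  ∃[ y ] (P y × (∀ z → P z → f z ≤ f y))
  argmax-Fin-on f P? {x₀} px₀ =
    argmax f x₀ xs , argmax-all f px₀ (all-filter P? (allFin n)) ,
    λ z pz → All.lookup (f[xs]≤f[argmax] x₀ xs) (∈-filter⁺ P? (∈-allFin z) pz)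
    where xs = filter P? (allFin n)

++-≡⇒suffix : ∀ {A : Set} (p₁ p₂ : List A) {s₁ s₂ : List A} → p₁ ++ s₁ ≡ p₂ ++ s₂ →
              (∃[ mid ] s₁ ≡ mid ++ s₂) ⊎ (∃[ mid ] s₂ ≡ mid ++ s₁)
++-≡⇒suffix [] p₂ eq = inj₁ (p₂ , eq)
++-≡⇒suffix (x ∷ p₁) [] eq = inj₂ (x ∷ p₁ , sym eq)
++-≡⇒suffix (_ ∷ p₁) (_ ∷ p₂) eq = ++-≡⇒suffix p₁ p₂ (∷-injectiveʳ eq)

module TreePaths {n : ℕ} {Adj : Fin n → Fin n → Set} (tree : IsTree n Adj) where
  open IsTree tree renaming (sym to Adj-sym)
  open DecMembership (Fin._≟_ {n}) using (_∈?_) public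

  V : Set
  V = Fin n

  T : Graph
  T = treeGraph n Adj

  private variable
    a b c u v x y : V
    xs ys zs : List V

  data Chain : V → List V → V → Set where
    end  : Chain v [] v
    step : Adj u a → Chain a xs v → Chain u (a ∷ xs) v

  Path : V → V → Set
  Path u v = ∃[ xs ] (Chain u xs v × Unique (u ∷ xs))

  Unique-head : Unique (x ∷ xs) → x ∉ xs
  Unique-head (x∉ ∷ _) = All¬⇒¬Any x∉

  Chain-end-∈ : Chain u (a ∷ xs) v → v ∈ a ∷ xs
  Chain-end-∈ (step _ end) = here refl
  Chain-end-∈ (step _ (step a ch)) = there (Chain-end-∈ (step a ch))

  Chain-[]⇒≡ : Chain u [] v → u ≡ v
  Chain-[]⇒≡ end = refl

  Chain⇒Linked : Chain u xs v → Adj v y → Linked Adj (u ∷ xs ++ y ∷ [])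
  Chain⇒Linked end vy = vy ∷ [-]
  Chain⇒Linked (step a ch) vy = a ∷ Chain⇒Linked ch vy

  Chain⇒Walk : ∀ pre → Chain u (pre ++ a ∷ xs) v → Walk T u a (suc (length pre))
  Chain⇒Walk [] (step ua _) = cons ua nil
  Chain⇒Walk (_ ∷ pre) (step ua ch) = cons ua (Chain⇒Walk pre ch)

  Path-from : u ∈ (a ∷ xs) → Chain a xs v → Unique (a ∷ xs) → Path u v
  Path-from (here refl) ch un = _ , ch , un
  Path-from (there u∈) (step _ ch) (_ ∷ un) = Path-from u∈ ch un

  Walk⇒Path : ∀ {k} → Walk T u v k → Path u v
  Walk⇒Path nil = [] , end , [] ∷ []
  Walk⇒Path {u} (cons {w = a} ua rest) with Walk⇒Path rest
  ... | xs , ch , un with u ∈? (a ∷ xs)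
  ...   | yes u∈ = Path-from u∈ ch un
  ...   | no u∉ = a ∷ xs , step ua ch , ¬Any⇒All¬ _ u∉ ∷ un

  Chain-prefix : a ∈ zs → Chain c zs v → Unique (c ∷ zs) →
                 ∃[ ps ] (Chain c ps a × Unique (c ∷ ps) × ps ⊆ zs)
  Chain-prefix (here refl) (step ca _) ((c≢a ∷ _) ∷ _) =
    _ ∷ [] , step ca end , (c≢a ∷ []) ∷ [] ∷ [] , λ { (here e) → here e }
  Chain-prefix (there a∈) (step ca ch) ((c≢ ∷ c∉) ∷ un) with Chain-prefix a∈ ch un
  ... | ps , ch′ , un′ , ps⊆ =
    _ ∷ ps , step ca ch′ , (c≢ ∷ anti-mono ps⊆ c∉) ∷ un′ ,
    λ { (here e) → here e ; (there p) → there (ps⊆ p) }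

  no-back-edge : Adj x b → Chain b zs v → Unique (x ∷ b ∷ zs) → a ∈ zs → Adj a x → ⊥
  no-back-edge {x} {b} {a = a} xb ch ((x≢b ∷ x∉) ∷ un@(b∉ ∷ _)) a∈ ax
    with Chain-prefix a∈ ch un
  ... | ps , ch′ , un′ , ps⊆ =
    acyclic x (b ∷ ps) (two≤ ps ch′) ((x≢b ∷ anti-mono ps⊆ x∉) ∷ un′) (Chain⇒Linked (step xb ch′) ax)
    where
    two≤ : ∀ ps → Chain b ps a → 2 ≤ length (b ∷ ps)
    two≤ [] ch = ⊥-elim (All¬⇒¬Any b∉ (subst (_∈ _) (sym (Chain-[]⇒≡ ch)) a∈))
    two≤ (_ ∷ _) _ = s≤s (s≤s z≤n)

  Path-unique : Chain u xs v → Unique (u ∷ xs) → Chain u ys v → Unique (u ∷ ys) → xs ≡ ys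
  Path-unique end _ end _ = refl
  Path-unique end _ (step a ch) un = ⊥-elim (Unique-head un (Chain-end-∈ (step a ch)))
  Path-unique (step a ch) un end _ = ⊥-elim (Unique-head un (Chain-end-∈ (step a ch)))
  Path-unique {u} (step {a = a} ua ch) un₁@(_ ∷ un₁′) (step {a = b} ub ch₂) un₂@(_ ∷ un₂′) with a Fin.≟ b
  ... | yes refl = cong (a ∷_) (Path-unique ch un₁′ ch₂ un₂′)
  ... | no a≢b with a ∈? (b ∷ _)
  ...   | yes (here a≡b) = ⊥-elim (a≢b a≡b)
  ...   | yes (there a∈) = ⊥-elim (no-back-edge ub ch₂ un₂ a∈ (Adj-sym ua))
  ...   | no a∉ = ⊥-elim (Unique-head un₁ (there (subst (u ∈_) (sym detour) (here refl))))
    where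
    -- a, u, b, … would be a second path from a to v
    detour = Path-unique ch un₁′ (step (Adj-sym ua) (step ub ch₂))
               (¬Any⇒All¬ _ (λ { (here a≡u) → irrefl (subst (Adj u) a≡u ua) ; (there a∈) → a∉ a∈ }) ∷ un₂)

module RootedTree {n : ℕ} {Adj : Fin n → Fin n → Set} (tree : IsTree n Adj) (r : Fin n) where
  open TreePaths tree public
  open IsTree tree renaming (sym to Adj-sym)

  private variable
    c p x y z : V
    xs ys : List V

  opaque
    path-to-root : (x : V) → Path x r
    path-to-root x = Walk⇒Path (proj₂ (connected x r))

  ancestors⁺ : V → List V
  ancestors⁺ x = proj₁ (path-to-root x)

  ancestors : V → List V
  ancestors x = x ∷ ancestors⁺ x

  Chain-to-root : Chain x (ancestors⁺ x) r
  Chain-to-root {x} = proj₁ (proj₂ (path-to-root x))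

  Unique-ancestors : Unique (ancestors x)
  Unique-ancestors {x} = proj₂ (proj₂ (path-to-root x))

  path-to-root-unique : Chain x xs r → Unique (x ∷ xs) → xs ≡ ancestors⁺ x
  path-to-root-unique ch un = Path-unique ch un Chain-to-root Unique-ancestors

  lev : V → ℕ
  lev x = length (ancestors⁺ x)

  infix 4 _⊑_
  _⊑_ : V → V → Set
  y ⊑ x = y ∈ ancestors x

  suffix-of-path-to-root : Chain x xs r → Unique (x ∷ xs) →
                           ∀ pre → x ∷ xs ≡ pre ++ y ∷ ys → y ∷ ys ≡ ancestors y
  suffix-of-path-to-root ch un [] eq with ∷-injective eq
  ... | refl , refl = cong (_ ∷_) (path-to-root-unique ch un)
  suffix-of-path-to-root (step _ ch) (_ ∷ un) (_ ∷ pre) eq =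
    suffix-of-path-to-root ch un pre (∷-injectiveʳ eq)
  suffix-of-path-to-root end _ (_ ∷ []) ()
  suffix-of-path-to-root end _ (_ ∷ _ ∷ _) ()

  ⊑⇒ancestors-++ : y ⊑ x → ∃[ pre ] ancestors x ≡ pre ++ ancestors y
  ⊑⇒ancestors-++ y⊑x with ∈-∃++ y⊑x
  ... | pre , _ , eq = pre , trans eq (cong (pre ++_) (suffix-of-path-to-root Chain-to-root Unique-ancestors pre eq))

  ⊑-refl : x ⊑ x
  ⊑-refl = here refl

  ⊑-trans : z ⊑ y → y ⊑ x → z ⊑ x
  ⊑-trans {z} z⊑y y⊑x with ⊑⇒ancestors-++ y⊑x
  ... | pre , eq = subst (z ∈_) (sym eq) (∈-++⁺ʳ pre z⊑y)

  lev-++ : ∀ pre → ancestors x ≡ pre ++ ancestors y → lev x ≡ length pre + lev y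
  lev-++ {x} {y} pre eq = begin
    lev x                                ≡⟨ cong (pred ∘ length) eq ⟩
    pred (length (pre ++ ancestors y))   ≡⟨ cong pred (length-++ pre) ⟩
    pred (length pre + suc (lev y))      ≡⟨ cong pred (+-suc (length pre) (lev y)) ⟩
    length pre + lev y                   ∎
    where open ≡-Reasoning

  lev-mono : y ⊑ x → lev y ≤ lev x
  lev-mono {y} y⊑x with ⊑⇒ancestors-++ y⊑x
  ... | pre , eq = subst (lev y ≤_) (sym (lev-++ pre eq)) (m≤n+m (lev y) (length pre))

  ⊑∧lev≡⇒≡ : y ⊑ x → lev y ≡ lev x → y ≡ x
  ⊑∧lev≡⇒≡ {y} y⊑x lev≡ with ⊑⇒ancestors-++ y⊑x
  ... | [] , eq = sym (∷-injectiveˡ eq)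
  ... | _ ∷ pre , eq = contradiction (trans lev≡ (lev-++ (_ ∷ pre) eq)) (m≢1+n+m (lev y))

  walk-up : y ⊑ x → Walk T x y (lev x ∸ lev y)
  walk-up {y} {x} y⊑x with ⊑⇒ancestors-++ y⊑x
  ... | pre , eq = subst (Walk T x y) (trans (sym (m+n∸n≡m (length pre) (lev y))) (cong (_∸ lev y) (sym (lev-++ pre eq))))
                         (along pre eq)
    where
    along : ∀ pre → ancestors x ≡ pre ++ ancestors y → Walk T x y (length pre)
    along [] eq rewrite ∷-injectiveˡ eq = nil
    along (_ ∷ pre) eq = Chain⇒Walk pre (subst (λ xs → Chain x xs r) (∷-injectiveʳ eq) Chain-to-root)

  ⊑-total : y ⊑ x → z ⊑ x → y ⊑ z ⊎ z ⊑ y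
  ⊑-total {y} {x} {z} y⊑x z⊑x with ⊑⇒ancestors-++ y⊑x | ⊑⇒ancestors-++ z⊑x
  ... | pre₁ , eq₁ | pre₂ , eq₂ with ++-≡⇒suffix pre₁ pre₂ (trans (sym eq₁) eq₂)
  ...   | inj₁ (mid , eq) = inj₂ (subst (z ∈_) (sym eq) (∈-++⁺ʳ mid ⊑-refl))
  ...   | inj₂ (mid , eq) = inj₁ (subst (y ∈_) (sym eq) (∈-++⁺ʳ mid ⊑-refl))

  r⊑ : r ⊑ x
  r⊑ = ends-at-r Chain-to-root
    where
    ends-at-r : Chain x xs r → r ∈ x ∷ xs
    ends-at-r end = here refl
    ends-at-r (step _ ch) = there (ends-at-r ch)

  ancestors⁺-root : ancestors⁺ r ≡ []
  ancestors⁺-root = sym (path-to-root-unique end ([] ∷ []))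

  lev-root : lev r ≡ 0
  lev-root = cong length ancestors⁺-root

  ⊑r⇒≡r : y ⊑ r → y ≡ r
  ⊑r⇒≡r {y} y⊑r with subst (y ∈_) (cong (r ∷_) ancestors⁺-root) y⊑r
  ... | here y≡r = y≡r

  infix 4 _ChildOf_
  _ChildOf_ : V → V → Set
  c ChildOf p = ancestors⁺ c ≡ ancestors p

  lev-child : c ChildOf p → lev c ≡ suc (lev p)
  lev-child = cong length

  ChildOf⇒⊑ : c ChildOf p → p ⊑ c
  ChildOf⇒⊑ c↑p = there (subst (_ ∈_) (sym c↑p) ⊑-refl)

  ChildOf⇒Adj : c ChildOf p → Adj c p
  ChildOf⇒Adj {c} c↑p with subst (λ xs → Chain c xs r) c↑p Chain-to-root
  ... | step cp _ = cp

  parent-of : lev x ≡ suc k → ∃[ p ] x ChildOf p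
  parent-of {x} = view (ancestors⁺ x) Chain-to-root Unique-ancestors refl
    where
    view : ∀ xs → Chain x xs r → Unique (x ∷ xs) → xs ≡ ancestors⁺ x → length xs ≡ suc k → ∃[ p ] x ChildOf p
    view (p ∷ _) (step _ ch) (_ ∷ un) eq _ = p , trans (sym eq) (cong (p ∷_) (path-to-root-unique ch un))

  ⊑-parent : c ChildOf p → y ⊑ c → lev y < lev c → y ⊑ p
  ⊑-parent c↑p (here refl) lt = contradiction lt (<-irrefl refl)
  ⊑-parent {y = y} c↑p (there y∈) _ = subst (y ∈_) c↑p y∈

  Adj⇒ChildOf : Adj x y → x ChildOf y ⊎ y ChildOf x
  Adj⇒ChildOf {x} {y} xy with y ∈? ancestors x
  ... | no y∉ = inj₂ (sym (path-to-root-unique (step (Adj-sym xy) Chain-to-root) (¬Any⇒All¬ _ y∉ ∷ Unique-ancestors)))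
  ... | yes (here y≡x) = ⊥-elim (irrefl (subst (Adj x) y≡x xy))
  ... | yes (there y∈) = inj₁ (parent (ancestors⁺ x) Chain-to-root Unique-ancestors refl y∈)
    where
    parent : ∀ xs → Chain x xs r → Unique (x ∷ xs) → xs ≡ ancestors⁺ x → y ∈ xs → x ChildOf y
    parent (_ ∷ _) (step _ ch) (_ ∷ un) eq (here refl) = trans (sym eq) (cong (y ∷_) (path-to-root-unique ch un))
    parent (_ ∷ _) (step xp ch) un _ (there y∈) = ⊥-elim (no-back-edge xp ch un y∈ (Adj-sym xy))

  first-in : List V → List V → V
  first-in [] ys = r
  first-in (x ∷ xs) ys with x ∈? ys
  ... | yes _ = x
  ... | no _ = first-in xs ys

  first-in-∉ : x ∉ ys → first-in (x ∷ xs) ys ≡ first-in xs ys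
  first-in-∉ {x} {ys} x∉ with x ∈? ys
  ... | yes x∈ = ⊥-elim (x∉ x∈)
  ... | no _ = refl

  first-in-∈ : r ∈ ys → first-in xs ys ∈ ys
  first-in-∈ {xs = []} r∈ = r∈
  first-in-∈ {ys} {x ∷ xs} r∈ with x ∈? ys
  ... | yes x∈ = x∈
  ... | no _ = first-in-∈ {xs = xs} r∈

  first-in-split : r ∈ xs → r ∈ ys →
                   ∃[ pre ] ∃[ post ] (xs ≡ pre ++ first-in xs ys ∷ post × All (_∉ ys) pre)
  first-in-split {x ∷ xs} {ys} r∈xs r∈ys with x ∈? ys
  ... | yes _ = [] , xs , refl , []
  ... | no x∉ with r∈xs
  ...   | here refl = ⊥-elim (x∉ r∈ys)
  ...   | there r∈ with first-in-split r∈ r∈ys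
  ...     | pre , post , eq , pre∉ = x ∷ pre , post , cong (x ∷_) eq , x∉ ∷ pre∉

  opaque
    lca : V → V → V
    lca x y = first-in (ancestors x) (ancestors y)

  opaque
    unfolding lca

    lca-⊑ʳ : lca x y ⊑ y
    lca-⊑ʳ {x} = first-in-∈ {xs = ancestors x} r⊑

    lca-split : ∃[ pre ] (ancestors x ≡ pre ++ ancestors (lca x y) × All (_∉ ancestors y) pre)
    lca-split {x} {y} with first-in-split {xs = ancestors x} {ys = ancestors y} r⊑ r⊑
    ... | pre , _ , eq , pre∉ =
      pre , trans eq (cong (pre ++_) (suffix-of-path-to-root Chain-to-root Unique-ancestors pre eq)) , pre∉

    lca-child : c ChildOf p → c ⊑ y ⊎ lca c y ≡ lca p y
    lca-child {c} {p} {y} c↑p = by-cases (c ∈? ancestors y)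
      where
      by-cases : Dec (c ⊑ y) → c ⊑ y ⊎ lca c y ≡ lca p y
      by-cases (yes c⊑y) = inj₁ c⊑y
      by-cases (no c⋢y) = inj₂ (trans (first-in-∉ c⋢y) (cong (λ xs → first-in xs (ancestors y)) c↑p))

  lca-⊑ˡ : lca x y ⊑ x
  lca-⊑ˡ {x} {y} with lca-split {x} {y}
  ... | pre , eq , _ = subst (_ ∈_) (sym eq) (∈-++⁺ʳ pre ⊑-refl)

  lca-greatest : z ⊑ x → z ⊑ y → z ⊑ lca x y
  lca-greatest {z} {x} {y} z⊑x z⊑y with lca-split {x} {y}
  ... | pre , eq , pre∉ with ∈-++⁻ pre (subst (z ∈_) eq z⊑x)
  ...   | inj₁ z∈pre = ⊥-elim (All.lookup pre∉ z∈pre z⊑y)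
  ...   | inj₂ z⊑lca = z⊑lca

  meet : V → V → ℕ
  meet x y = lev (lca x y)

  meet≤levˡ : meet x y ≤ lev x
  meet≤levˡ {x} {y} = lev-mono (lca-⊑ˡ {x} {y})

  meet≤levʳ : meet x y ≤ lev y
  meet≤levʳ {x} {y} = lev-mono (lca-⊑ʳ {x} {y})

  meet-comm : ∀ x y → meet x y ≡ meet y x
  meet-comm x y = ≤-antisym (lev-mono (lca-greatest (lca-⊑ʳ {x} {y}) (lca-⊑ˡ {x} {y})))
                            (lev-mono (lca-greatest (lca-⊑ʳ {y} {x}) (lca-⊑ˡ {y} {x})))

  meet-⊑ : x ⊑ y → meet x y ≡ lev x
  meet-⊑ {x} {y} x⊑y = ≤-antisym (meet≤levˡ {x} {y}) (lev-mono (lca-greatest ⊑-refl x⊑y))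

  meet-self : ∀ x → meet x x ≡ lev x
  meet-self x = meet-⊑ ⊑-refl

  meet-root : ∀ x → meet x r ≡ 0
  meet-root x = trans (cong lev (⊑r⇒≡r (lca-⊑ʳ {x} {r}))) lev-root

  meet-ultra : ∀ x y z → meet x y ≤ meet x z ⊎ meet y z ≤ meet x z
  meet-ultra x y z with ⊑-total (lca-⊑ʳ {x} {y}) (lca-⊑ˡ {y} {z})
  ... | inj₁ xy⊑yz = inj₁ (lev-mono (lca-greatest (lca-⊑ˡ {x} {y}) (⊑-trans xy⊑yz (lca-⊑ʳ {y} {z}))))
  ... | inj₂ yz⊑xy = inj₂ (lev-mono (lca-greatest (⊑-trans yz⊑xy (lca-⊑ˡ {x} {y})) (lca-⊑ʳ {y} {z})))

  meet-child : c ChildOf p → c ⊑ y ⊎ meet c y ≡ meet p y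
  meet-child c↑p = map₂ (cong lev) (lca-child c↑p)

  -- c lies on the path from x to z
  Between : V → V → V → Set
  Between x c z = (meet c z ≡ lev c × meet x z ≡ meet x c) ⊎ (meet x c ≡ lev c × meet x z ≡ meet c z)

-- The length of the tree path from x to y when an edge between levels k and
-- k + 1 has length g (k + 1) ∸ g k: g = id gives the tree distance, and
-- g = ⌊_/2⌋ the distance between super-vertices.
module LevelMetric {n : ℕ} {Adj : Fin n → Fin n → Set} (tree : IsTree n Adj) (r : Fin n)
                   (g : ℕ → ℕ) (g-mono : ∀ {i j} → i ≤ j → g i ≤ g j) where
  open RootedTree tree r

  private variable
    c p x y z : V

  dist : V → V → ℕ
  dist x y = (g (lev x) ∸ g (meet x y)) + (g (lev y) ∸ g (meet x y))

  dist-self : ∀ x → dist x x ≡ 0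
  dist-self x rewrite meet-self x | n∸n≡0 (g (lev x)) = refl

  dist-comm : ∀ x y → dist x y ≡ dist y x
  dist-comm x y rewrite meet-comm x y = +-comm (g (lev x) ∸ g (meet y x)) (g (lev y) ∸ g (meet y x))

  dist-child : c ChildOf p → ∀ y →
               dist p y ≡ dist c y + (g (lev c) ∸ g (lev p)) ⊎ dist c y ≡ dist p y + (g (lev c) ∸ g (lev p))
  dist-child {c} {p} c↑p y with meet-child {y = y} c↑p
  ... | inj₁ c⊑y
    rewrite meet-⊑ c⊑y | meet-⊑ (⊑-trans (ChildOf⇒⊑ c↑p) c⊑y) | n∸n≡0 (g (lev c)) | n∸n≡0 (g (lev p)) =
    inj₁ (m∸o≡[m∸n]+[n∸o] (g-mono lev-p≤lev-c) (g-mono (lev-mono c⊑y)))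
    where lev-p≤lev-c = lev-mono (ChildOf⇒⊑ c↑p)
  ... | inj₂ meet≡ rewrite meet≡ =
    inj₂ (trans (cong (_+ Y) (m∸o≡[m∸n]+[n∸o] (g-mono (meet≤levˡ {p} {y})) (g-mono (lev-mono (ChildOf⇒⊑ c↑p)))))
                (solve 3 (λ δ P Y → (δ :+ P) :+ Y := (P :+ Y) :+ δ) refl
                       (g (lev c) ∸ g (lev p)) (g (lev p) ∸ g (meet p y)) Y))
    where Y = g (lev y) ∸ g (meet p y)

  private
    one-step-apart : ∀ {A B δ} → δ ≤ 1 → A ≡ B + δ ⊎ B ≡ A + δ → A ≤ suc B
    one-step-apart {A} {B} δ≤1 (inj₁ A≡) = ≤-trans (≤-reflexive A≡) (≤-trans (+-monoʳ-≤ B δ≤1) (≤-reflexive (+-comm B 1)))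
    one-step-apart {A} {B} δ≤1 (inj₂ B≡) = ≤-trans (m≤m+n A _) (≤-trans (≤-reflexive (sym B≡)) (n≤1+n B))

    edge≤1 : (∀ k → g (suc k) ∸ g k ≤ 1) → c ChildOf p → g (lev c) ∸ g (lev p) ≤ 1
    edge≤1 {c} {p} unit c↑p rewrite lev-child c↑p = unit (lev p)

  dist-Lipschitz : (∀ k → g (suc k) ∸ g k ≤ 1) → Adj x y → ∀ t → dist x t ≤ suc (dist y t)
  dist-Lipschitz unit xy t with Adj⇒ChildOf xy
  ... | inj₁ x↑y = one-step-apart (edge≤1 unit x↑y) (swap (dist-child x↑y t))
  ... | inj₂ y↑x = one-step-apart (edge≤1 unit y↑x) (dist-child y↑x t)

  dist-Between : Between x c z → dist x z ≡ dist x c + dist c z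
  dist-Between {x} {c} {z} (inj₁ (meet-cz≡ , meet-xz≡)) rewrite meet-cz≡ | meet-xz≡ | n∸n≡0 (g (lev c)) =
    trans (cong (X +_) (m∸o≡[m∸n]+[n∸o] (g-mono (meet≤levʳ {x} {c})) (g-mono lev-c≤lev-z)))
          (solve 3 (λ X Z C → X :+ (Z :+ C) := (X :+ C) :+ Z) refl X (g (lev z) ∸ g (lev c)) (g (lev c) ∸ g (meet x c)))
    where
    X = g (lev x) ∸ g (meet x c)
    lev-c≤lev-z = subst (_≤ lev z) meet-cz≡ (meet≤levʳ {c} {z})
  dist-Between {x} {c} {z} (inj₂ (meet-xc≡ , meet-xz≡)) rewrite meet-xc≡ | meet-xz≡ | n∸n≡0 (g (lev c)) =
    trans (cong (_+ Z) (m∸o≡[m∸n]+[n∸o] (g-mono (meet≤levˡ {c} {z})) (g-mono lev-c≤lev-x)))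
          (solve 3 (λ X C Z → (X :+ C) :+ Z := (X :+ con 0) :+ (C :+ Z)) refl (g (lev x) ∸ g (lev c)) (g (lev c) ∸ g (meet c z)) Z)
    where
    Z = g (lev z) ∸ g (meet c z)
    lev-c≤lev-x = subst (_≤ lev x) meet-xc≡ (meet≤levˡ {x} {c})

module TreeMetrics {n : ℕ} {Adj : Fin n → Fin n → Set} (tree : IsTree n Adj) (r : Fin n) where
  open RootedTree tree r public
  open IsTree tree using () renaming (sym to Adj-sym)
  open LevelMetric tree r id id public using ()
    renaming (dist to d; dist-self to d-self; dist-comm to d-comm; dist-Between to d-Between)
  open LevelMetric tree r id id using () renaming (dist-Lipschitz to d-Lipschitz)
  open LevelMetric tree r ⌊_/2⌋ ⌊n/2⌋-mono public using ()
    renaming (dist to w; dist-self to w-self; dist-comm to w-comm; dist-child to w-child;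
              dist-Lipschitz to w-Lipschitz; dist-Between to w-Between)

  private variable
    a b c x y z : V

  d-walk : ∀ x y → Walk T x y (d x y)
  d-walk x y = walk-up (lca-⊑ˡ {x} {y}) ++ʷ reverseʷ Adj-sym (walk-up (lca-⊑ʳ {x} {y}))

  d-Dist : ∀ x y → Dist T x y (d x y)
  d-Dist x y = Dist-by-potential (λ z → d z y) (d-self y) (λ a → d-Lipschitz (λ k → ≤-reflexive (m+n∸n≡m 1 k)) a y)
                                 (d-walk x y)

  d-triangle : ∀ x y z → d x z ≤ d x y + d y z
  d-triangle x y z = Dist-triangle (d-Dist x y) (d-Dist y z) (d-Dist x z)

  lev-Dist : ∀ x → Dist T x r (lev x)
  lev-Dist x = subst (Dist T x r) d-to-root (d-Dist x r)
    where
    d-to-root : d x r ≡ lev x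
    d-to-root rewrite meet-root x | lev-root = +-identityʳ (lev x)

  d+2meet≡lev+lev : ∀ x y → d x y + (meet x y + meet x y) ≡ lev x + lev y
  d+2meet≡lev+lev x y =
    trans (solve 3 (λ A B M → (A :+ B) :+ (M :+ M) := (A :+ M) :+ (B :+ M)) refl (lev x ∸ meet x y) (lev y ∸ meet x y) (meet x y))
          (cong₂ _+_ (m∸n+n≡m (meet≤levˡ {x} {y})) (m∸n+n≡m (meet≤levʳ {x} {y})))

  Geodesic : V → V → V → Set
  Geodesic x c z = d x z ≡ d x c + d c z

  meet-Geodesic : Geodesic x c z → meet x c + meet c z ≡ lev c + meet x z
  meet-Geodesic {x} {c} {z} geo = +-self-injective (+-cancelˡ-≡ (lev x + lev z) _ _ (begin
    (lev x + lev z) + ((A + B) + (A + B))                    ≡⟨ cong (_+ ((A + B) + (A + B))) (sym (d+2meet≡lev+lev x z)) ⟩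
    (d x z + (L + L)) + ((A + B) + (A + B))                  ≡⟨ cong (λ t → (t + (L + L)) + ((A + B) + (A + B))) geo ⟩
    ((d x c + d c z) + (L + L)) + ((A + B) + (A + B))        ≡⟨ solve 5 (λ D₁ D₂ A B L → ((D₁ :+ D₂) :+ (L :+ L)) :+ ((A :+ B) :+ (A :+ B))
                                                                  := ((D₁ :+ (A :+ A)) :+ (D₂ :+ (B :+ B))) :+ (L :+ L)) refl (d x c) (d c z) A B L ⟩
    ((d x c + (A + A)) + (d c z + (B + B))) + (L + L)        ≡⟨ cong (_+ (L + L)) (cong₂ _+_ (d+2meet≡lev+lev x c) (d+2meet≡lev+lev c z)) ⟩
    ((lev x + lev c) + (lev c + lev z)) + (L + L)            ≡⟨ solve 4 (λ X C Z L → ((X :+ C) :+ (C :+ Z)) :+ (L :+ L)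
                                                                  := (X :+ Z) :+ ((C :+ L) :+ (C :+ L))) refl (lev x) (lev c) (lev z) L ⟩
    (lev x + lev z) + ((lev c + L) + (lev c + L))            ∎))
    where
    open ≡-Reasoning
    A = meet x c
    B = meet c z
    L = meet x z

  -- In the names below xc abbreviates meet x c, and a lone c abbreviates lev c.
  Geodesic⇒Between : Geodesic x c z → Between x c z
  Geodesic⇒Between {x} {c} {z} geo with meet-ultra x c z
  ... | inj₁ xc≤xz = inj₁ (cz≡c , sym (+-cancelʳ-≡ (lev c) (meet x c) (meet x z) (begin
      meet x c + lev c       ≡⟨ cong (meet x c +_) (sym cz≡c) ⟩
      meet x c + meet c z    ≡⟨ sum≡ ⟩
      lev c + meet x z       ≡⟨ +-comm (lev c) (meet x z) ⟩
      meet x z + lev c       ∎)))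
    where
    open ≡-Reasoning
    sum≡ = meet-Geodesic geo
    cz≡c : meet c z ≡ lev c
    cz≡c = ≤-antisym (meet≤levˡ {c} {z}) (+-cancelʳ-≤ (meet x z) (lev c) (meet c z)
            (≤-trans (≤-reflexive (sym sum≡)) (≤-trans (+-monoˡ-≤ (meet c z) xc≤xz) (≤-reflexive (+-comm (meet x z) (meet c z))))))
  ... | inj₂ cz≤xz = inj₂ (xc≡c , sym (+-cancelˡ-≡ (lev c) (meet c z) (meet x z) (trans (cong (_+ meet c z) (sym xc≡c)) sum≡)))
    where
    sum≡ = meet-Geodesic geo
    xc≡c : meet x c ≡ lev c
    xc≡c = ≤-antisym (meet≤levʳ {x} {c}) (+-cancelʳ-≤ (meet x z) (lev c) (meet x c)
            (≤-trans (≤-reflexive (sym sum≡)) (+-monoʳ-≤ (meet x c) cz≤xz)))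

  w-Geodesic : Geodesic x c z → w x z ≡ w x c + w c z
  w-Geodesic geo = w-Between (Geodesic⇒Between geo)

  private
    fork : meet c b ≡ lev c → meet a b ≡ meet a c → ∀ x → Geodesic x c a ⊎ Geodesic x c b
    fork {c} {b} {a} cb≡c ab≡ac x with meet x c ≟ lev c
    ... | no xc≢c = inj₂ (d-Between (inj₁ (cb≡c , ≤-antisym xb≤xc xc≤xb)))
      where
      xc<c : meet x c < lev c
      xc<c = ≤∧≢⇒< (meet≤levʳ {x} {c}) xc≢c
      xb≤xc : meet x b ≤ meet x c
      xb≤xc with meet-ultra x b c
      ... | inj₁ le = le
      ... | inj₂ le = contradiction (≤-trans (≤-reflexive (sym (trans (meet-comm b c) cb≡c))) le) (<⇒≱ xc<c)
      xc≤xb : meet x c ≤ meet x b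
      xc≤xb with meet-ultra x c b
      ... | inj₁ le = le
      ... | inj₂ le = contradiction (≤-trans (≤-reflexive (sym cb≡c)) (≤-trans le xb≤xc)) (<⇒≱ xc<c)
    ... | yes xc≡c with meet x b ≟ lev c
    ...   | yes xb≡c = inj₂ (d-Between (inj₂ (xc≡c , trans xb≡c (sym cb≡c))))
    ...   | no xb≢c = inj₁ (d-Between (inj₂ (xc≡c , trans xa≡ac (meet-comm a c))))
      where
      c<xb : lev c < meet x b
      c<xb with meet-ultra x c b
      ... | inj₁ le = ≤∧≢⇒< (subst (_≤ meet x b) xc≡c le) (xb≢c ∘ sym)
      ... | inj₂ le = ≤∧≢⇒< (subst (_≤ meet x b) cb≡c le) (xb≢c ∘ sym)
      ax≤ac : meet a x ≤ meet a c
      ax≤ac with meet-ultra a x b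
      ... | inj₁ le = subst (meet a x ≤_) ab≡ac le
      ... | inj₂ le = contradiction (≤-trans le (≤-trans (≤-reflexive ab≡ac) (meet≤levʳ {a} {c}))) (<⇒≱ c<xb)
      ac≤xa : meet a c ≤ meet x a
      ac≤xa with meet-ultra x c a
      ... | inj₁ le = ≤-trans (meet≤levʳ {a} {c}) (subst (_≤ meet x a) xc≡c le)
      ... | inj₂ le = subst (_≤ meet x a) (meet-comm c a) le
      xa≡ac : meet x a ≡ meet a c
      xa≡ac = ≤-antisym (subst (_≤ meet a c) (meet-comm a x) ax≤ac) ac≤xa

  Geodesic-fork : Geodesic a c b → ∀ x → Geodesic x c a ⊎ Geodesic x c b
  Geodesic-fork {a} {c} {b} geo x with Geodesic⇒Between geo
  ... | inj₁ (cb≡c , ab≡ac) = fork cb≡c ab≡ac x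
  ... | inj₂ (ac≡c , ab≡cb) = swap (fork (trans (meet-comm c a) ac≡c) (trans (meet-comm b a) (trans ab≡cb (meet-comm c b))) x)

  w+w+parities≡d+parities : ∀ x y → (w x y + w x y) + parity (lev x) + parity (lev y) ≡ d x y + (parity (meet x y) + parity (meet x y))
  w+w+parities≡d+parities x y =
    trans (solve 4 (λ P Q a b → ((P :+ Q) :+ (P :+ Q)) :+ a :+ b := (P :+ P :+ a) :+ (Q :+ Q :+ b)) refl Px Py (parity (lev x)) (parity (lev y)))
          (trans (cong₂ _+_ (⌊/2⌋-∸ (meet≤levˡ {x} {y})) (⌊/2⌋-∸ (meet≤levʳ {x} {y})))
                 (solve 3 (λ X Y R → (X :+ R) :+ (Y :+ R) := (X :+ Y) :+ (R :+ R)) refl (lev x ∸ meet x y) (lev y ∸ meet x y) (parity (meet x y))))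
    where
    Px = ⌊ lev x /2⌋ ∸ ⌊ meet x y /2⌋
    Py = ⌊ lev y /2⌋ ∸ ⌊ meet x y /2⌋

  d≤⇒w≤1+w : d c y ≤ d c z → w c y ≤ suc (w c z)
  d≤⇒w≤1+w {c} {y} {z} le = m+m≤3+n+n⇒m≤1+n (+-cancelʳ-≤ pc (w c y + w c y) _ (begin
    (w c y + w c y) + pc                         ≤⟨ m≤m+n _ (parity (lev y)) ⟩
    (w c y + w c y) + pc + parity (lev y)        ≡⟨ w+w+parities≡d+parities c y ⟩
    d c y + (parity (meet c y) + parity (meet c y)) ≤⟨ +-mono-≤ le (+-mono-≤ (parity≤1 (meet c y)) (parity≤1 (meet c y))) ⟩
    d c z + 2                                    ≤⟨ +-monoˡ-≤ 2 (m≤m+n (d c z) (parity (meet c z) + parity (meet c z))) ⟩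
    d c z + (parity (meet c z) + parity (meet c z)) + 2 ≡⟨ cong (_+ 2) (sym (w+w+parities≡d+parities c z)) ⟩
    (w c z + w c z) + pc + parity (lev z) + 2    ≤⟨ +-monoˡ-≤ 2 (+-monoʳ-≤ ((w c z + w c z) + pc) (parity≤1 (lev z))) ⟩
    (w c z + w c z) + pc + 1 + 2                 ≡⟨ solve 2 (λ W P → ((W :+ P) :+ con 1) :+ con 2 := (con 3 :+ W) :+ P) refl (w c z + w c z) pc ⟩
    3 + (w c z + w c z) + pc                     ∎))
    where
    open ≤-Reasoning
    pc = parity (lev c)

  w-adjacent : d a b ≡ 1 → w a b ≤ 1
  w-adjacent {a} {b} d≡1 = m+m≤3+n+n⇒m≤1+n (begin
    w a b + w a b                                    ≤⟨ ≤-trans (m≤m+n (w a b + w a b) (parity (lev a))) (m≤m+n _ (parity (lev b))) ⟩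
    (w a b + w a b) + parity (lev a) + parity (lev b) ≡⟨ w+w+parities≡d+parities a b ⟩
    d a b + (parity (meet a b) + parity (meet a b))  ≤⟨ +-mono-≤ (≤-reflexive d≡1) (+-mono-≤ (parity≤1 (meet a b)) (parity≤1 (meet a b))) ⟩
    3                                                ∎)
    where open ≤-Reasoning

  -- Trees are bipartite.
  d-adjacent : d a b ≡ 1 → ∀ y → d a y ≡ suc (d b y) ⊎ d b y ≡ suc (d a y)
  d-adjacent {a} {b} d≡1 y with <-cmp (d a y) (d b y)
  ... | tri< lt _ _ = inj₂ (≤-antisym (subst (λ t → d b y ≤ t + d a y) (trans (d-comm b a) d≡1) (d-triangle b a y)) lt)
  ... | tri> _ _ gt = inj₁ (≤-antisym (subst (λ t → d a y ≤ t + d b y) d≡1 (d-triangle a b y)) gt)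
  ... | tri≈ _ eq _ = contradiction parity-clash (m+m≢1+n+n (t + A + B) (M + lev y))
    where
    open ≡-Reasoning
    t = d a y
    A = meet a y
    B = meet b y
    M = meet a b
    parity-clash : (t + A + B) + (t + A + B) ≡ suc ((M + lev y) + (M + lev y))
    parity-clash = begin
      (t + A + B) + (t + A + B)         ≡⟨ solve 3 (λ t a b → (t :+ a :+ b) :+ (t :+ a :+ b) := (t :+ (a :+ a)) :+ (t :+ (b :+ b))) refl t A B ⟩
      (t + (A + A)) + (t + (B + B))     ≡⟨ cong₂ _+_ (d+2meet≡lev+lev a y) (trans (cong (_+ (B + B)) eq) (d+2meet≡lev+lev b y)) ⟩
      (lev a + lev y) + (lev b + lev y) ≡⟨ solve 3 (λ a b c → (a :+ c) :+ (b :+ c) := (a :+ b) :+ (c :+ c)) refl (lev a) (lev b) (lev y) ⟩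
      (lev a + lev b) + (lev y + lev y) ≡⟨ cong (_+ (lev y + lev y)) (sym (trans (cong (_+ (M + M)) (sym d≡1)) (d+2meet≡lev+lev a b))) ⟩
      (1 + (M + M)) + (lev y + lev y)   ≡⟨ solve 2 (λ a c → (con 1 :+ (a :+ a)) :+ (c :+ c) := con 1 :+ ((a :+ c) :+ (a :+ c))) refl M (lev y) ⟩
      suc ((M + lev y) + (M + lev y))   ∎

module Contraction {n : ℕ} {Adj : Fin n → Fin n → Set} (tree : IsTree n Adj) (r : Fin n) where
  open TreeMetrics tree r public
  open OutwardContraction n Adj r public using (SuperVertex; PAdj; PartitionGraph; φ-maps; InSuper; Down; EvenLev; Lev)
  open IsTree tree using () renaming (sym to Adj-sym)

  private variable
    g p u v x : V

  P : Graph
  P = PartitionGraph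

  Lev⇒≡lev : Lev x k → k ≡ lev x
  Lev⇒≡lev {x} l = Dist-unique l (lev-Dist x)

  Even⇒EvenLev : Even (lev x) → EvenLev x
  Even⇒EvenLev {x} e = lev x , lev-Dist x , Even⇒2∣ e

  EvenLev⇒Even : EvenLev x → Even (lev x)
  EvenLev⇒Even (k , l , 2∣k) = subst Even (Lev⇒≡lev l) (2∣⇒Even 2∣k)

  super : (x : V) → Even (lev x) → SuperVertex
  super x e = x , [ Even⇒EvenLev e ]

  Even-generator : (S : SuperVertex) → Even (lev (proj₁ S))
  Even-generator (v , [ e ]) with even-or-odd (lev v)
  ... | inj₁ even = even
  ... | inj₂ odd = ⊥-elim-irr (even⇒¬odd (EvenLev⇒Even e) odd)

  Down⇒ChildOf : Down v u → u ChildOf v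
  Down⇒ChildOf {v} {u} (vu , kv , ku , lv , lu , kv<ku) with Adj⇒ChildOf vu
  ... | inj₂ u↑v = u↑v
  ... | inj₁ v↑u = contradiction (subst₂ _<_ (Lev⇒≡lev lv) (Lev⇒≡lev lu) kv<ku)
                                 (<⇒≯ (≤-reflexive (sym (lev-child v↑u))))

  ChildOf⇒Down : u ChildOf v → Down v u
  ChildOf⇒Down {u} {v} u↑v =
    Adj-sym (ChildOf⇒Adj u↑v) , lev v , lev u , lev-Dist v , lev-Dist u , ≤-reflexive (sym (lev-child u↑v))

  InSuper⇒⊑ : InSuper v x → v ⊑ x
  InSuper⇒⊑ (inj₁ refl) = ⊑-refl
  InSuper⇒⊑ (inj₂ down) = ChildOf⇒⊑ (Down⇒ChildOf down)

  ⌊lev/2⌋-InSuper : Even (lev v) → InSuper v x → ⌊ lev x /2⌋ ≡ ⌊ lev v /2⌋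
  ⌊lev/2⌋-InSuper e (inj₁ refl) = refl
  ⌊lev/2⌋-InSuper e (inj₂ down) rewrite lev-child (Down⇒ChildOf down) = even⇒⌊1+n/2⌋≡⌊n/2⌋ e

  w-InSuper : Even (lev v) → InSuper v x → ∀ t → w x t ≡ w v t
  w-InSuper e (inj₁ refl) t = refl
  w-InSuper {v} e x∈v@(inj₂ down) t with w-child (Down⇒ChildOf down) t | ⌊lev/2⌋-InSuper e x∈v
  ... | inj₁ eq | half≡ rewrite half≡ | n∸n≡0 ⌊ lev v /2⌋ = sym (trans eq (+-identityʳ _))
  ... | inj₂ eq | half≡ rewrite half≡ | n∸n≡0 ⌊ lev v /2⌋ = trans eq (+-identityʳ _)

  PAdj-sym : ∀ {S S′} → PAdj S S′ → PAdj S′ S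
  PAdj-sym (S≢S′ , a , b , a∈S , b∈S′ , ab) = S≢S′ ∘ sym , b , a , b∈S′ , a∈S , Adj-sym ab

  w-Lipschitz-P : ∀ t → Lipschitz {P} (λ S → w (proj₁ S) t)
  w-Lipschitz-P t {S} {S′} (_ , a , b , a∈S , b∈S′ , ab) =
    subst₂ (λ p q → p ≤ suc q) (w-InSuper (Even-generator S) a∈S t) (w-InSuper (Even-generator S′) b∈S′ t)
           (w-Lipschitz ⌊1+n/2⌋∸⌊n/2⌋≤1 ab t)

  PAdj-grandchild : (ex : Even (lev x)) (eg : Even (lev g)) → x ChildOf p → p ChildOf g →
                    PAdj (super x ex) (super g eg)
  PAdj-grandchild {x} ex eg x↑p p↑g =
    (λ { refl → m≢1+n+m (lev x) (trans (lev-child x↑p) (cong suc (lev-child p↑g))) }) ,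
    x , _ , inj₁ refl , inj₂ (ChildOf⇒Down p↑g) , ChildOf⇒Adj x↑p

  walk-up-P : ∀ k {x y} (ex : Even (lev x)) (ey : Even (lev y)) → y ⊑ x → lev x ≡ (k + k) + lev y →
              Walk P (super x ex) (super y ey) k
  walk-up-P zero ex ey y⊑x lev≡ = stay ex ey (⊑∧lev≡⇒≡ y⊑x (sym lev≡))
    where
    stay : ∀ {x y} (ex : Even (lev x)) (ey : Even (lev y)) → y ≡ x → Walk P (super x ex) (super y ey) 0
    stay _ _ refl = nil
  walk-up-P (suc k) {x} {y} ex ey y⊑x lev≡ = climb (parent-of lev-x≡)
    where
    lev-x≡ : lev x ≡ suc (suc ((k + k) + lev y))
    lev-x≡ = trans lev≡ (cong (λ m → suc m + lev y) (+-suc k k))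
    climb : ∃[ p ] x ChildOf p → Walk P (super x ex) (super y ey) (suc k)
    climb (p , x↑p) = cons (PAdj-grandchild ex egp x↑p p↑gp) (walk-up-P k egp ey y⊑gp lev-gp≡)
      where
      lev-p≡ : lev p ≡ suc ((k + k) + lev y)
      lev-p≡ = suc-injective (trans (sym (lev-child x↑p)) lev-x≡)
      gp = proj₁ (parent-of lev-p≡)
      p↑gp = proj₂ (parent-of lev-p≡)
      lev-gp≡ : lev gp ≡ (k + k) + lev y
      lev-gp≡ = suc-injective (trans (sym (lev-child p↑gp)) lev-p≡)
      egp : Even (lev gp)
      egp = Even-ss⁻¹ (subst Even (trans (lev-child x↑p) (cong suc (lev-child p↑gp))) ex)
      y<p : lev y < lev p
      y<p = subst (lev y <_) (sym lev-p≡) (s≤s (m≤n+m (lev y) (k + k)))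
      y⊑gp : y ⊑ gp
      y⊑gp = ⊑-parent p↑gp (⊑-parent x↑p y⊑x (<-trans y<p (subst (lev p <_) (sym (lev-child x↑p)) (n<1+n (lev p))))) y<p

  record Generator (x : V) : Set where
    field
      gen      : V
      even     : Even (lev gen)
      contains : InSuper gen x

  generator : ∀ x → Generator x
  generator x with even-or-odd (lev x)
  ... | inj₁ e = record { gen = x ; even = e ; contains = inj₁ refl }
  ... | inj₂ o = let (p , x↑p) = parent-of (proj₂ (odd⇒≡suc o)) in
    record { gen = p ; even = Even-ss⁻¹ (subst (Even ∘ suc) (lev-child x↑p) o) ; contains = inj₂ (ChildOf⇒Down x↑p) }

  φ : V → SuperVertex
  φ x = super gen even
    where open Generator (generator x)

  φ-maps-φ : ∀ x → φ-maps x (φ x)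
  φ-maps-φ x = Generator.contains (generator x)

  w-φ : ∀ x t → w x t ≡ w (proj₁ (φ x)) t
  w-φ x t = w-InSuper even contains t
    where open Generator (generator x)

  dist-P : SuperVertex → SuperVertex → ℕ
  dist-P S S′ = w (proj₁ S) (proj₁ S′)

  w-walk-P : ∀ S S′ → Walk P S S′ (dist-P S S′)
  w-walk-P S@(v , _) S′@(v′ , _) =
    subst (Walk P S S′) (cong (λ h → (⌊ lev v /2⌋ ∸ h) + (⌊ lev v′ /2⌋ ∸ h)) half-gen≡)
          (walk-from S (lca-⊑ˡ {v} {v′}) ++ʷ reverseʷ (λ {S} {S″} → PAdj-sym {S} {S″}) (walk-from S′ (lca-⊑ʳ {v} {v′})))
    where
    open Generator (generator (lca v v′))
    half-gen≡ : ⌊ lev gen /2⌋ ≡ ⌊ meet v v′ /2⌋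
    half-gen≡ = sym (⌊lev/2⌋-InSuper even contains)
    walk-from : ∀ S → lca v v′ ⊑ proj₁ S → Walk P S (super gen even) (⌊ lev (proj₁ S) /2⌋ ∸ ⌊ lev gen /2⌋)
    walk-from S ℓ⊑ = walk-up-P _ (Even-generator S) even gen⊑ (even-halves even (Even-generator S) (lev-mono gen⊑))
      where gen⊑ = ⊑-trans (InSuper⇒⊑ contains) ℓ⊑

  w-Dist-P : ∀ S S′ → Dist P S S′ (dist-P S S′)
  w-Dist-P S S′ = Dist-by-potential (λ S″ → dist-P S″ S′) (w-self (proj₁ S′))
                                    (λ {S} {S″} → w-Lipschitz-P (proj₁ S′) {S} {S″}) (w-walk-P S S′)

module Center {n : ℕ} {Adj : Fin n → Fin n → Set} (tree : IsTree n Adj) (r : Fin n) where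
  open Contraction tree r public

  private variable
    c v x y z : V

  w-φ² : ∀ x y → w x y ≡ w (proj₁ (φ x)) (proj₁ (φ y))
  w-φ² x y = trans (w-φ x y) (trans (w-comm _ y) (trans (w-φ y _) (w-comm _ _)))

  w-triangle : ∀ x y z → w x z ≤ w x y + w y z
  w-triangle x y z = subst₂ _≤_ (sym (w-φ² x z)) (cong₂ _+_ (sym (w-φ² x y)) (sym (w-φ² y z)))
                       (Dist-triangle (w-Dist-P (φ x) (φ y)) (w-Dist-P (φ y) (φ z)) (w-Dist-P (φ x) (φ z)))

  Geodesic-comm : Geodesic x c z → Geodesic z c x
  Geodesic-comm {x} {c} {z} geo =
    trans (d-comm z x) (trans geo (trans (+-comm (d x c) (d c z)) (cong₂ _+_ (d-comm c z) (d-comm x c))))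

  split-geodesic : ∀ {a b} i j → d a b ≡ i + j → ∃[ c ] (d a c ≤ i × d c b ≤ j)
  split-geodesic {a} {b} i j eq with splitʷ i (subst (Walk T a b) eq (d-walk a b))
  ... | c , p₁ , p₂ = c , proj₂ (d-Dist a c) i p₁ , proj₂ (d-Dist c b) j p₂

  split-geodesic-at-edge : ∀ {a b} i j → d a b ≡ i + suc j → ∃₂ λ c₁ c₂ → d a c₁ ≤ i × d c₁ c₂ ≤ 1 × d c₂ b ≤ j
  split-geodesic-at-edge {a} {b} i j eq with splitʷ i (subst (Walk T a b) eq (d-walk a b))
  ... | c₁ , p₁ , cons {w = c₂} e p₂ =
    c₁ , c₂ , proj₂ (d-Dist a c₁) i p₁ , proj₂ (d-Dist c₁ c₂) 1 (cons e nil) , proj₂ (d-Dist c₂ b) j p₂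

  Central : V → Set
  Central u = MinimalEccentricity d u × MinimalEccentricity w u

  w-close : w v c ≡ 0 → ∃[ x ] (∀ y → w c y ≤ w v x)
  w-close {v} {c} w≡0 =
    let (z , far) = argmax-Fin (w c) c
    in z , λ y → ≤-trans (far y) (≤-trans (w-triangle c v z) (≤-reflexive (cong (_+ w v z) (trans (w-comm c v) w≡0))))

  1+w≤w-beyond : 1 ≤ w v c → Geodesic v c z → suc (w c z) ≤ w v z
  1+w≤w-beyond {v} {c} {z} pos geo = subst (suc (w c z) ≤_) (sym (w-Geodesic {v} {c} {z} geo)) (+-monoˡ-≤ (w c z) pos)

  -- Beyond c, as seen from v, the w-distance gains w v c ≥ 1, which absorbs
  -- the slack of d≤⇒w≤1+w.
  w-beyond : 1 ≤ w v c → Geodesic v c z → (∀ y → d c y ≤ d c z) → ∀ y → w c y ≤ w v z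
  w-beyond {v} {c} {z} pos geo d≤ y = ≤-trans (d≤⇒w≤1+w {c} {y} {z} (d≤ y)) (1+w≤w-beyond {v} {c} {z} pos geo)

  central-of-even-diameter : ∀ {a b} R → d a b ≡ R + R → (∀ x y → d x y ≤ R + R) → Σ V Central
  central-of-even-diameter {a} {b} R d≡ diam = mid , d-central , w-central
    where
    split = split-geodesic R R d≡
    mid = proj₁ split
    a-mid≤R = proj₁ (proj₂ split)
    mid-b≤R = proj₂ (proj₂ split)
    R+R≤ : R + R ≤ d a mid + d mid b
    R+R≤ = subst (_≤ d a mid + d mid b) d≡ (d-triangle a mid b)
    mid-a≡R : d mid a ≡ R
    mid-a≡R = trans (d-comm mid a) (≤-tightˡ a-mid≤R mid-b≤R R+R≤)
    mid-b≡R : d mid b ≡ R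
    mid-b≡R = ≤-tightʳ a-mid≤R mid-b≤R R+R≤
    ends : ∀ v → ∃[ z ] (d mid z ≡ R × Geodesic v mid z)
    geo-amb : Geodesic a mid b
    geo-amb = trans d≡ (sym (cong₂ _+_ (trans (d-comm a mid) mid-a≡R) mid-b≡R))
    ends v = towards (Geodesic-fork geo-amb v)
      where
      towards : Geodesic v mid a ⊎ Geodesic v mid b → ∃[ z ] (d mid z ≡ R × Geodesic v mid z)
      towards (inj₁ geo) = a , mid-a≡R , geo
      towards (inj₂ geo) = b , mid-b≡R , geo
    ecc-mid : ∀ y → d mid y ≤ R
    ecc-mid y = let (z , mid-z≡R , geo) = ends y in
      subst (_≤ R) (d-comm y mid) (+-cancelʳ-≤ R (d y mid) R (subst (_≤ R + R) (trans geo (cong (d y mid +_) mid-z≡R)) (diam y z)))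
    d-central : MinimalEccentricity d mid
    d-central v = let (z , mid-z≡R , geo) = ends v in
      z , λ y → ≤-trans (ecc-mid y) (subst (R ≤_) (sym (trans geo (cong (d v mid +_) mid-z≡R))) (m≤n+m R (d v mid)))
    w-central : MinimalEccentricity w mid
    w-central v = by-cases (w v mid ≟ 0)
      where
      by-cases : Dec (w v mid ≡ 0) → ∃[ x ] (∀ y → w mid y ≤ w v x)
      by-cases (yes w≡0) = w-close w≡0
      by-cases (no w≢0) = let (z , mid-z≡R , geo) = ends v in
        z , w-beyond (n≢0⇒n>0 w≢0) geo (λ y → subst (d mid y ≤_) (sym mid-z≡R) (ecc-mid y))

  record Bicentre : Set where
    field
      c₁ c₂ a b : V
      R         : ℕ
      a-c₁      : d a c₁ ≡ R
      c₁-c₂     : d c₁ c₂ ≡ 1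
      c₂-b      : d c₂ b ≡ R
      c₁-b      : d c₁ b ≡ suc R
      a-c₂      : d a c₂ ≡ suc R
      diameter  : ∀ x y → d x y ≤ suc (R + R)

  Bicentre-swap : Bicentre → Bicentre
  Bicentre-swap B = record
    { c₁ = c₂ ; c₂ = c₁ ; a = b ; b = a ; R = R
    ; a-c₁ = trans (d-comm b c₂) c₂-b ; c₁-c₂ = trans (d-comm c₂ c₁) c₁-c₂ ; c₂-b = trans (d-comm c₁ a) a-c₁
    ; c₁-b = trans (d-comm c₂ a) a-c₂ ; a-c₂ = trans (d-comm b c₁) c₁-b ; diameter = diameter }
    where open Bicentre B

  module Sides (B : Bicentre) where
    open Bicentre B

    Near₁ Near₂ : V → Set
    Near₁ y = d c₂ y ≡ suc (d c₁ y)
    Near₂ y = d c₁ y ≡ suc (d c₂ y)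

    side : ∀ y → Near₂ y ⊎ Near₁ y
    side = d-adjacent {c₁} {c₂} c₁-c₂

    Geodesic-across : Near₁ y → Near₂ x → Geodesic x c₁ y
    Geodesic-across {y} {x} near₁ near₂ = through (Geodesic-fork {c₂} {c₁} {y} c₂-c₁-y x)
      where
      c₂-c₁-y : Geodesic c₂ c₁ y
      c₂-c₁-y = trans near₁ (cong (_+ d c₁ y) (sym (trans (d-comm c₂ c₁) c₁-c₂)))
      through : Geodesic x c₁ c₂ ⊎ Geodesic x c₁ y → Geodesic x c₁ y
      through (inj₂ geo) = geo
      through (inj₁ geo) = contradiction (trans geo (cong₂ _+_ (trans (d-comm x c₁) (trans near₂ (cong suc (d-comm c₂ x)))) c₁-c₂))
                                         (m≢m+1+n (d x c₂))
        where
        m≢m+1+n : ∀ m → m ≢ suc m + 1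
        m≢m+1+n m eq = m≢1+n+m m (trans eq (cong suc (+-comm m 1)))

    Near₁-a : Near₁ a
    Near₁-a = trans (d-comm c₂ a) (trans a-c₂ (cong suc (trans (sym a-c₁) (d-comm a c₁))))

    Near₂-b : Near₂ b
    Near₂-b = trans c₁-b (cong suc (sym c₂-b))

    Near₁-c₁ : Near₁ c₁
    Near₁-c₁ = trans (d-comm c₂ c₁) (trans c₁-c₂ (cong suc (sym (d-self c₁))))

    Near₁⇒≤R : Near₁ y → d c₁ y ≤ R
    Near₁⇒≤R {y} near₁ = +-cancelˡ-≤ (suc R) (d c₁ y) R
      (subst (_≤ suc (R + R)) (trans (Geodesic-across near₁ Near₂-b) (cong (_+ d c₁ y) (trans (d-comm b c₁) c₁-b)))
             (diameter b y))

  module BicentreCentral (B : Bicentre) where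
    open Bicentre B
    open Sides B
    private module Swapped = Sides (Bicentre-swap B)

    d-c₁≤ : ∀ y → d c₁ y ≤ suc R
    d-c₁≤ y = by-side (side y)
      where
      by-side : Near₂ y ⊎ Near₁ y → d c₁ y ≤ suc R
      by-side (inj₁ near₂) = ≤-trans (≤-reflexive near₂) (s≤s (Swapped.Near₁⇒≤R near₂))
      by-side (inj₂ near₁) = ≤-trans (Near₁⇒≤R near₁) (n≤1+n R)

    d-central : MinimalEccentricity d c₁
    d-central v = by-side (side v)
      where
      beyond : ∀ {c z} → Geodesic v c z → d c z ≡ suc R → ∀ y → d c₁ y ≤ d v z
      beyond {c} {z} geo cz≡ y = ≤-trans (d-c₁≤ y) (subst (suc R ≤_) (sym (trans geo (cong (d v c +_) cz≡))) (m≤n+m (suc R) (d v c)))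
      by-side : Near₂ v ⊎ Near₁ v → ∃[ x ] (∀ y → d c₁ y ≤ d v x)
      by-side (inj₁ near₂) = a , beyond (Geodesic-comm {a} {c₂} {v} (Swapped.Geodesic-across near₂ Near₁-a)) (trans (d-comm c₂ a) a-c₂)
      by-side (inj₂ near₁) = b , beyond (Geodesic-comm {b} {c₁} {v} (Geodesic-across near₁ Near₂-b)) c₁-b

    w-central : ∀ y₁ → Near₁ y₁ → (∀ y → Near₁ y → w c₁ y ≤ w c₁ y₁) → (∀ y → Near₂ y → w c₂ y ≤ w c₁ y₁) →
                MinimalEccentricity w c₁
    w-central y₁ near-y₁ max₁ max₂ v = by-cases (w v c₁ ≟ 0)
      where
      w-c₁≤ : ∀ y → w c₁ y ≤ suc (w c₁ y₁)
      w-c₁≤ y = by-side (side y)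
        where
        by-side : Near₂ y ⊎ Near₁ y → w c₁ y ≤ suc (w c₁ y₁)
        by-side (inj₁ near₂) = ≤-trans (≤-reflexive (w-Geodesic {c₁} {c₂} {y} (trans near₂ (cong (_+ d c₂ y) (sym c₁-c₂)))))
                                       (+-mono-≤ (w-adjacent {c₁} {c₂} c₁-c₂) (max₂ y near₂))
        by-side (inj₂ near₁) = ≤-trans (max₁ y near₁) (n≤1+n _)
      by-side : 1 ≤ w v c₁ → Near₂ v ⊎ Near₁ v → ∃[ x ] (∀ y → w c₁ y ≤ w v x)
      by-side pos (inj₁ near₂) = y₁ , λ y → ≤-trans (w-c₁≤ y) (1+w≤w-beyond {v} {c₁} {y₁} pos (Geodesic-across near-y₁ near₂))
      by-side pos (inj₂ near₁) = b , w-beyond {v} {c₁} {b} pos (Geodesic-comm {b} {c₁} {v} (Geodesic-across near₁ Near₂-b))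
                                               (λ y → subst (d c₁ y ≤_) (sym c₁-b) (d-c₁≤ y))
      by-cases : Dec (w v c₁ ≡ 0) → ∃[ x ] (∀ y → w c₁ y ≤ w v x)
      by-cases (yes w≡0) = w-close w≡0
      by-cases (no w≢0) = by-side (n≢0⇒n>0 w≢0) (side v)

  Bicentre-of-odd-diameter : ∀ {a b} R → d a b ≡ suc (R + R) → (∀ x y → d x y ≤ suc (R + R)) → Bicentre
  Bicentre-of-odd-diameter {a} {b} R d≡ diam = record
    { c₁ = c₁ ; c₂ = c₂ ; a = a ; b = b ; R = R ; a-c₁ = a-c₁ ; c₁-c₂ = c₁-c₂ ; c₂-b = c₂-b
    ; c₁-b = c₁-b ; a-c₂ = a-c₂ ; diameter = diam }
    where
    d≡′ : d a b ≡ R + suc R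
    d≡′ = trans d≡ (sym (+-suc R R))
    split = split-geodesic-at-edge R R d≡′
    c₁ = proj₁ split
    c₂ = proj₁ (proj₂ split)
    a-c₁≤ : d a c₁ ≤ R
    a-c₁≤ = proj₁ (proj₂ (proj₂ split))
    c₁-c₂≤ : d c₁ c₂ ≤ 1
    c₁-c₂≤ = proj₁ (proj₂ (proj₂ (proj₂ split)))
    c₂-b≤ : d c₂ b ≤ R
    c₂-b≤ = proj₂ (proj₂ (proj₂ (proj₂ split)))
    R+1+R≤ : R + (1 + R) ≤ d a c₁ + (d c₁ c₂ + d c₂ b)
    R+1+R≤ = subst (_≤ d a c₁ + (d c₁ c₂ + d c₂ b)) d≡′ (≤-trans (d-triangle a c₁ b) (+-monoʳ-≤ (d a c₁) (d-triangle c₁ c₂ b)))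
    a-c₁ : d a c₁ ≡ R
    a-c₁ = ≤-tightˡ a-c₁≤ (+-mono-≤ c₁-c₂≤ c₂-b≤) R+1+R≤
    1+R≤ : 1 + R ≤ d c₁ c₂ + d c₂ b
    1+R≤ = ≤-reflexive (sym (≤-tightʳ a-c₁≤ (+-mono-≤ c₁-c₂≤ c₂-b≤) R+1+R≤))
    c₁-c₂ : d c₁ c₂ ≡ 1
    c₁-c₂ = ≤-tightˡ c₁-c₂≤ c₂-b≤ 1+R≤
    c₂-b : d c₂ b ≡ R
    c₂-b = ≤-tightʳ c₁-c₂≤ c₂-b≤ 1+R≤
    c₁-b : d c₁ b ≡ suc R
    c₁-b = ≤-antisym (subst (d c₁ b ≤_) (cong₂ _+_ c₁-c₂ c₂-b) (d-triangle c₁ c₂ b))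
                     (+-cancelˡ-≤ R (suc R) (d c₁ b) (subst₂ _≤_ d≡′ (cong (_+ d c₁ b) a-c₁) (d-triangle a c₁ b)))
    a-c₂ : d a c₂ ≡ suc R
    a-c₂ = ≤-antisym (subst (d a c₂ ≤_) (trans (cong₂ _+_ a-c₁ c₁-c₂) (+-comm R 1)) (d-triangle a c₁ c₂))
                     (+-cancelʳ-≤ R (suc R) (d a c₂) (subst₂ _≤_ d≡ (cong (d a c₂ +_) c₂-b) (d-triangle a c₂ b)))

  central-of-Bicentre : Bicentre → Σ V Central
  central-of-Bicentre B = choose (w c₂ y₂ ≤? w c₁ y₁)
    where
    open Bicentre B
    open Sides B
    module Swapped = Sides (Bicentre-swap B)
    farthest₁ = argmax-Fin-on (w c₁) (λ y → d c₂ y ≟ suc (d c₁ y)) Near₁-c₁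
    farthest₂ = argmax-Fin-on (w c₂) (λ y → d c₁ y ≟ suc (d c₂ y)) Swapped.Near₁-c₁
    y₁ = proj₁ farthest₁
    y₂ = proj₁ farthest₂
    choose : Dec (w c₂ y₂ ≤ w c₁ y₁) → Σ V Central
    choose (yes ≤) = c₁ , d-central , w-central y₁ (proj₁ (proj₂ farthest₁)) (proj₂ (proj₂ farthest₁))
                                      (λ y near₂ → ≤-trans (proj₂ (proj₂ farthest₂) y near₂) ≤)
      where open BicentreCentral B
    choose (no ≰) = c₂ , d-central , w-central y₂ (proj₁ (proj₂ farthest₂)) (proj₂ (proj₂ farthest₂))
                                     (λ y near₁ → ≤-trans (proj₂ (proj₂ farthest₁) y near₁) (<⇒≤ (≰⇒> ≰)))
      where open BicentreCentral (Bicentre-swap B)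

  central-exists : Σ V Central
  central-exists = by-parity (even-or-odd (d a b))
    where
    far-from = λ x → proj₁ (argmax-Fin (d x) x)
    eccentric = argmax-Fin (λ x → d x (far-from x)) r
    a = proj₁ eccentric
    b = far-from a
    diam : ∀ x y → d x y ≤ d a b
    diam x y = ≤-trans (proj₂ (argmax-Fin (d x) x) y) (proj₂ eccentric x)
    by-parity : Even (d a b) ⊎ Even (suc (d a b)) → Σ V Central
    by-parity (inj₁ even) = central-of-even-diameter ⌊ d a b /2⌋ (even⇒n≡⌊n/2⌋+⌊n/2⌋ even)
                              (λ x y → subst (d x y ≤_) (even⇒n≡⌊n/2⌋+⌊n/2⌋ even) (diam x y))
    by-parity (inj₂ odd) = central-of-Bicentre (Bicentre-of-odd-diameter ⌊ d a b /2⌋ (odd⇒n≡1+⌊n/2⌋+⌊n/2⌋ odd)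
                              (λ x y → subst (d x y ≤_) (odd⇒n≡1+⌊n/2⌋+⌊n/2⌋ odd) (diam x y)))

  φ-MinimalEccentricity : ∀ {u} → MinimalEccentricity w u → MinimalEccentricity dist-P (φ u)
  φ-MinimalEccentricity {u} min S′ =
    let (x , u≤) = min (proj₁ S′) in
    φ x , λ S → subst₂ _≤_ (w-φ u (proj₁ S)) (trans (w-comm (proj₁ S′) x) (trans (w-φ x (proj₁ S′)) (w-comm _ (proj₁ S′))))
                        (u≤ (proj₁ S))

  φ-Farthest : ∀ {u z} → Farthest w u z → Farthest dist-P (φ u) (φ z)
  φ-Farthest {u} {z} far S = subst₂ _≤_ (w-φ u (proj₁ S)) (w-φ² u z) (far (proj₁ S))

  InCenter-T : ∀ {u} → MinimalEccentricity d u → InCenter T u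
  InCenter-T {u} min = let (z , far) = argmax-Fin (d u) u in
    InCenter-by-MinimalEccentricity d d-Dist {u} {z} far min

  InCenter-P : ∀ {u} → MinimalEccentricity w u → InCenter P (φ u)
  InCenter-P {u} min = let (z , far) = argmax-Fin (w u) u in
    InCenter-by-MinimalEccentricity dist-P w-Dist-P {φ u} {φ z} (φ-Farthest {u} {z} far) (φ-MinimalEccentricity min)

theorem5 : (n : ℕ) (Adj : Fin n → Fin n → Set) → IsTree n Adj → (r : Fin n) →
    ∃[ u ] (InCenter (treeGraph n Adj) u ×
    ∃[ S ] (OutwardContraction.φ-maps n Adj r u S ×
    InCenter (OutwardContraction.PartitionGraph n Adj r) S))
theorem5 n Adj tree r =
  let (u , d-central , w-central) = central-exists in
  u , InCenter-T d-central , φ u , φ-maps-φ u , InCenter-P w-central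
  where open Center tree r
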